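{- Let $r\ge 2$ and let $H=(V,\mathcal{E})$ be a hypergraph with $|V|=n$ in which every edge has at most $r$ vertices. Then every test cover $\mathcal{T}\subseteq\mathcal{E}$ has at least $\lceil \frac{2(n-1)}{r+1}\rceil$ edges. This lower bound is tight: there exist such hypergraphs (with edges of size at most $r$) with arbitrarily large $n$ admitting a test cover of size exactly $\frac{2(n-1)}{r+1}$. Furthermore, if $\mathcal{T}$ is a test cover of size exactly $\frac{2(n-1)}{r+1}$, then every vertex is contained in at most two edges of $\mathcal{T}$.
   Context: An edge $e$ separates vertices $x,y$ if $|\{x,y\}\cap e|=1$. A subcollection $\mathcal{T}\subseteq\mathcal{E}$ is a test cover if every pair of distinct vertices of $V$ is separated by some edge of $\mathcal{T}$. -}

module Defs where

open import Data.Nat using (ℕ; _+_; _*_; _∸_; _≤_; _/_; suc)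
open import Data.Fin using (Fin)
open import Data.Fin.Subset using (Subset; ∣_∣; _∈_)
open import Data.Fin.Subset.Properties using (_∈?_)
open import Data.List using (List; length; filter)
open import Data.List.Relation.Unary.All using (All)
open import Data.List.Relation.Unary.Any using (Any)
open import Data.Product using (_×_)
open import Data.Sum using (_⊎_)
open import Relation.Nullary using (¬_)
open import Relation.Binary.PropositionalEquality using (_≡_; _≢_)

Hypergraph : ℕ → Set
Hypergraph n = List (Subset n)

EdgesAtMost : {n : ℕ} → ℕ → Hypergraph n → Set
EdgesAtMost r E = All (λ e → ∣ e ∣ ≤ r) E

Separates : {n : ℕ} → Subset n → Fin n → Fin n → Set
Separates e x y = (x ∈ e × ¬ (y ∈ e)) ⊎ (y ∈ e × ¬ (x ∈ e))

IsTestCover : {n : ℕ} → List (Subset n) → Set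
IsTestCover {n} T = (x y : Fin n) → x ≢ y → Any (λ e → Separates e x y) T

degreeIn : {n : ℕ} → List (Subset n) → Fin n → ℕ
degreeIn T v = length (filter (λ e → v ∈? e) T)

-- ceiling division: ceilDiv a b = ⌈ a / (b + 1) ⌉
ceilDiv : ℕ → (b : ℕ) → ℕ
ceilDiv a b = (a + b) / suc b

module Submission where

-- Give a vertex of degree d in T the potential d + 2·[d = 0] + [d = 1]: it is at least 2,
-- and at least 3 once d ≥ 3. The degrees add up to the total edge size, at most r·|T|. In a
-- test cover at most one vertex lies in no edge, and no edge contains two vertices of degree 1
-- (no edge could separate them), so at most |T| vertices have degree 1. Hence
-- 2n ≤ 2 + (r + 1)|T|, strictly if some degree exceeds 2. Equality holds for one isolated
-- vertex plus disjoint copies of the hypergraph whose vertices are the edges of the complete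
-- graph on r + 1 nodes and whose edges are the stars of r of these nodes.

open import Defs
open import Data.Nat using (ℕ; zero; suc; _+_; _*_; _∸_; _≤_; _<_; _≥_; z≤n; s≤s; s≤s⁻¹; >-nonZero)
open import Data.Nat.Properties
open import Data.Nat.DivMod using (m<n*o⇒m/o<n)
open import Data.Nat.Solver using (module +-*-Solver)
open import Data.Bool using (if_then_else_)
open import Data.Fin using (Fin; zero; suc; _↑ˡ_; _↑ʳ_)
import Data.Fin.Properties as Fin
open import Data.Fin.Subset using (Subset; ∣_∣; _∈_; inside; outside; ⊥; ⊤; ⁅_⁆)
open import Data.Fin.Subset.Properties using (_∈?_; ∉⊥; ∈⊤; ∣⊥∣≡0; ∣⊤∣≡n; ∣⁅x⁆∣≡1; x∈⁅x⁆; x∈⁅y⁆⇒x≡y)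
open import Data.Vec using ([]; _∷_; here; there; _++_)
open import Data.List using (List; []; _∷_; length; map; tabulate) renaming (_++_ to _++ₗ_)
open import Data.List.Properties using (length-map; length-++; length-tabulate)
open import Data.List.Membership.Propositional using (find) renaming (_∈_ to _∈ₗ_)
open import Data.List.Membership.Propositional.Properties using (∈-filter⁺; ∈-length)
open import Data.List.Relation.Unary.All using (All; []; _∷_)
import Data.List.Relation.Unary.All as All
import Data.List.Relation.Unary.All.Properties as All
open import Data.List.Relation.Unary.Any using (Any; here)
import Data.List.Relation.Unary.Any as Any
import Data.List.Relation.Unary.Any.Properties as Any
open import Data.List.Relation.Binary.Sublist.Propositional using (_⊆_; ⊆-refl)
open import Data.List.Relation.Binary.Sublist.Propositional.Properties using (All-resp-⊆)
open import Data.Product using (_×_; Σ; ∃; _,_)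
import Data.Product as Product
open import Data.Sum using (inj₁; inj₂; swap)
import Data.Sum as Sum
open import Relation.Nullary using (Dec; yes; no; does; ¬_; contradiction)
open import Relation.Nullary.Decidable using (_×-dec_)
open import Relation.Unary using (Pred; Decidable)
open import Function using (_∘_)
open import Relation.Binary.PropositionalEquality
open import Algebra.Properties.Semiring.Sum +-*-semiring using (sum; sum-syntax; sum-cong-≗; ∑-distrib-+; *-distribˡ-sum)

-- Through `does` rather than yes/no patterns, so that 𝟙 (suc v ∈? s ∷ p) reduces to 𝟙 (v ∈? p).
𝟙 : ∀ {a} {A : Set a} → Dec A → ℕ
𝟙 d = if does d then 1 else 0

𝟙-×-dec : ∀ {a b} {A : Set a} {B : Set b} (d : Dec A) (d′ : Dec B) → 𝟙 (d ×-dec d′) ≡ 𝟙 d * 𝟙 d′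
𝟙-×-dec (yes _) (yes _) = refl
𝟙-×-dec (yes _) (no _)  = refl
𝟙-×-dec (no _)  _       = refl

∑-const : ∀ n c → ∑[ i < n ] c ≡ n * c
∑-const zero    c = refl
∑-const (suc n) c = cong (c +_) (∑-const n c)

∑-mono-≤ : ∀ {n} {f g : Fin n → ℕ} → (∀ i → f i ≤ g i) → sum f ≤ sum g
∑-mono-≤ {zero}  f≤g = z≤n
∑-mono-≤ {suc n} f≤g = +-mono-≤ (f≤g zero) (∑-mono-≤ (λ i → f≤g (suc i)))

∑-mono-< : ∀ {n} {f g : Fin n → ℕ} → (∀ i → f i ≤ g i) → (j : Fin n) → f j < g j → sum f < sum g
∑-mono-< f≤g zero    fj<gj = +-mono-<-≤ fj<gj (∑-mono-≤ (λ i → f≤g (suc i)))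
∑-mono-< f≤g (suc j) fj<gj = +-mono-≤-< (f≤g zero) (∑-mono-< (λ i → f≤g (suc i)) j fj<gj)

∑-𝟙-none : ∀ {n p} {P : Pred (Fin n) p} (P? : Decidable P) → (∀ v → ¬ P v) → ∑[ v < n ] 𝟙 (P? v) ≡ 0
∑-𝟙-none {zero}  P? none = refl
∑-𝟙-none {suc n} P? none with P? zero
... | yes p = contradiction p (none zero)
... | no _  = ∑-𝟙-none (P? ∘ suc) (none ∘ suc)

∑-𝟙-≤1 : ∀ {n p} {P : Pred (Fin n) p} (P? : Decidable P) →
         (∀ {x y} → P x → P y → x ≡ y) → ∑[ v < n ] 𝟙 (P? v) ≤ 1
∑-𝟙-≤1 {zero}  P? unique = z≤n
∑-𝟙-≤1 {suc n} P? unique with P? zero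
... | yes p₀ = ≤-reflexive (cong suc (∑-𝟙-none (P? ∘ suc) (λ v pv → Fin.0≢1+n (unique p₀ pv))))
... | no _   = ∑-𝟙-≤1 (P? ∘ suc) (λ px py → Fin.suc-injective (unique px py))

length≡1⇒∈-unique : ∀ {a} {A : Set a} {xs : List A} {x y : A} →
                    length xs ≡ 1 → x ∈ₗ xs → y ∈ₗ xs → x ≡ y
length≡1⇒∈-unique {xs = []}        _  ()
length≡1⇒∈-unique {xs = _ ∷ []}    _  (here refl) (here refl) = refl
length≡1⇒∈-unique {xs = _ ∷ _ ∷ _} ()

∑-𝟙∈≡∣∣ : ∀ {n} (p : Subset n) → ∑[ v < n ] 𝟙 (v ∈? p) ≡ ∣ p ∣
∑-𝟙∈≡∣∣ []            = refl
∑-𝟙∈≡∣∣ (inside ∷ p)  = cong suc (∑-𝟙∈≡∣∣ p)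
∑-𝟙∈≡∣∣ (outside ∷ p) = ∑-𝟙∈≡∣∣ p

module _ {n : ℕ} where

  open ≤-Reasoning

  degreeIn-∷ : ∀ e (T : List (Subset n)) v → degreeIn (e ∷ T) v ≡ 𝟙 (v ∈? e) + degreeIn T v
  degreeIn-∷ e T v with v ∈? e
  ... | yes _ = refl
  ... | no _  = refl

  ∈⇒degreeIn>0 : ∀ {T} {e : Subset n} {v} → e ∈ₗ T → v ∈ e → 0 < degreeIn T v
  ∈⇒degreeIn>0 {v = v} e∈T v∈e = ∈-length (∈-filter⁺ (v ∈?_) e∈T v∈e)

  degreeIn≡1⇒edge-unique : ∀ {T} {e e′ : Subset n} {v} → degreeIn T v ≡ 1 →
                           e ∈ₗ T → e′ ∈ₗ T → v ∈ e → v ∈ e′ → e ≡ e′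
  degreeIn≡1⇒edge-unique {v = v} deg≡1 e∈T e′∈T v∈e v∈e′ =
    length≡1⇒∈-unique deg≡1 (∈-filter⁺ (v ∈?_) e∈T v∈e) (∈-filter⁺ (v ∈?_) e′∈T v∈e′)

  ∑-degreeIn*-≤ : (w : Fin n → ℕ) {c : ℕ} (T : List (Subset n)) →
                  All (λ e → ∑[ v < n ] (𝟙 (v ∈? e) * w v) ≤ c) T →
                  ∑[ v < n ] (degreeIn T v * w v) ≤ c * length T
  ∑-degreeIn*-≤ w         []      []          = ≤-trans (≤-reflexive (trans (∑-const n 0) (*-zeroʳ n))) z≤n
  ∑-degreeIn*-≤ w {c} (e ∷ T) (e≤c ∷ T≤c) = begin
    ∑[ v < n ] (degreeIn (e ∷ T) v * w v)
      ≡⟨ sum-cong-≗ (λ v → cong (_* w v) (degreeIn-∷ e T v)) ⟩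
    ∑[ v < n ] ((𝟙 (v ∈? e) + degreeIn T v) * w v)
      ≡⟨ sum-cong-≗ (λ v → *-distribʳ-+ (w v) (𝟙 (v ∈? e)) (degreeIn T v)) ⟩
    ∑[ v < n ] (𝟙 (v ∈? e) * w v + degreeIn T v * w v)
      ≡⟨ ∑-distrib-+ (λ v → 𝟙 (v ∈? e) * w v) (λ v → degreeIn T v * w v) ⟩
    ∑[ v < n ] (𝟙 (v ∈? e) * w v) + ∑[ v < n ] (degreeIn T v * w v)
      ≤⟨ +-mono-≤ e≤c (∑-degreeIn*-≤ w T T≤c) ⟩
    c + c * length T
      ≡⟨ *-suc c (length T) ⟨
    c * length (e ∷ T) ∎

  ∑-degreeIn≤ : ∀ {r} {T : List (Subset n)} → EdgesAtMost r T →
                ∑[ v < n ] degreeIn T v ≤ r * length T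
  ∑-degreeIn≤ {r} {T} T≤r = begin
    ∑[ v < n ] degreeIn T v         ≡⟨ sum-cong-≗ (λ v → *-identityʳ (degreeIn T v)) ⟨
    ∑[ v < n ] (degreeIn T v * 1)   ≤⟨ ∑-degreeIn*-≤ (λ _ → 1) T (All.map (λ {e} → size e) T≤r) ⟩
    r * length T                    ∎
    where
    size : ∀ e → ∣ e ∣ ≤ r → ∑[ v < n ] (𝟙 (v ∈? e) * 1) ≤ r
    size e = subst (_≤ r) (trans (sym (∑-𝟙∈≡∣∣ e)) (sum-cong-≗ (λ v → sym (*-identityʳ (𝟙 (v ∈? e))))))

potential : ℕ → ℕ
potential d = 2 * 𝟙 (d ≟ 0) + (𝟙 (d ≟ 1) + d)

≤potential : ∀ d → d ≤ potential d
≤potential d = ≤-trans (m≤n+m d (𝟙 (d ≟ 1))) (m≤n+m (𝟙 (d ≟ 1) + d) (2 * 𝟙 (d ≟ 0)))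

2≤potential : ∀ d → 2 ≤ potential d
2≤potential 0             = ≤-refl
2≤potential 1             = ≤-refl
2≤potential (suc (suc d)) = ≤-trans (m≤m+n 2 d) (≤potential (2 + d))

𝟙[d≟1]≡d*𝟙[d≟1] : ∀ d → 𝟙 (d ≟ 1) ≡ d * 𝟙 (d ≟ 1)
𝟙[d≟1]≡d*𝟙[d≟1] 0             = refl
𝟙[d≟1]≡d*𝟙[d≟1] 1             = refl
𝟙[d≟1]≡d*𝟙[d≟1] (suc (suc d)) = sym (*-zeroʳ (suc (suc d)))

module _ {n : ℕ} {T : List (Subset n)} (cover : IsTestCover T) where

  open ≤-Reasoning

  degreeIn≡0-unique : ∀ {x y} → degreeIn T x ≡ 0 → degreeIn T y ≡ 0 → x ≡ y
  degreeIn≡0-unique {x} {y} x₀ y₀ with x Fin.≟ y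
  ... | yes x≡y = x≡y
  ... | no x≢y with find (cover x y x≢y)
  ... | e , e∈T , inj₁ (x∈e , _) = contradiction x₀ (≢-sym (<⇒≢ (∈⇒degreeIn>0 e∈T x∈e)))
  ... | e , e∈T , inj₂ (y∈e , _) = contradiction y₀ (≢-sym (<⇒≢ (∈⇒degreeIn>0 e∈T y∈e)))

  pendants-unique : ∀ {e x y} → e ∈ₗ T →
                    x ∈ e × degreeIn T x ≡ 1 → y ∈ e × degreeIn T y ≡ 1 → x ≡ y
  pendants-unique {e} {x} {y} e∈T (x∈e , x₁) (y∈e , y₁) with x Fin.≟ y
  ... | yes x≡y = x≡y
  ... | no x≢y with find (cover x y x≢y)
  ... | e′ , e′∈T , inj₁ (x∈e′ , y∉e′) =
    contradiction (subst (y ∈_) (degreeIn≡1⇒edge-unique x₁ e∈T e′∈T x∈e x∈e′) y∈e) y∉e′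
  ... | e′ , e′∈T , inj₂ (y∈e′ , x∉e′) =
    contradiction (subst (x ∈_) (degreeIn≡1⇒edge-unique y₁ e∈T e′∈T y∈e y∈e′) x∈e) x∉e′

  ∑-isolated≤1 : ∑[ v < n ] 𝟙 (degreeIn T v ≟ 0) ≤ 1
  ∑-isolated≤1 = ∑-𝟙-≤1 (λ v → degreeIn T v ≟ 0) degreeIn≡0-unique

  ∑-pendant≤ : ∑[ v < n ] 𝟙 (degreeIn T v ≟ 1) ≤ length T
  ∑-pendant≤ = begin
    ∑[ v < n ] 𝟙 (degreeIn T v ≟ 1)
      ≡⟨ sum-cong-≗ (λ v → 𝟙[d≟1]≡d*𝟙[d≟1] (degreeIn T v)) ⟩
    ∑[ v < n ] (degreeIn T v * 𝟙 (degreeIn T v ≟ 1))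
      ≤⟨ ∑-degreeIn*-≤ (λ v → 𝟙 (degreeIn T v ≟ 1)) T (All.tabulate edge-pendants≤1) ⟩
    1 * length T
      ≡⟨ *-identityˡ (length T) ⟩
    length T ∎
    where
    edge-pendants≤1 : ∀ {e} → e ∈ₗ T → ∑[ v < n ] (𝟙 (v ∈? e) * 𝟙 (degreeIn T v ≟ 1)) ≤ 1
    edge-pendants≤1 {e} e∈T =
      subst (_≤ 1) (sum-cong-≗ (λ v → 𝟙-×-dec (v ∈? e) (degreeIn T v ≟ 1)))
        (∑-𝟙-≤1 (λ v → v ∈? e ×-dec degreeIn T v ≟ 1) (pendants-unique e∈T))

  ∑-potential≤ : ∀ {r} → EdgesAtMost r T →
                 ∑[ v < n ] potential (degreeIn T v) ≤ 2 + suc r * length T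
  ∑-potential≤ {r} T≤r = begin
    ∑[ v < n ] potential (deg v)
      ≡⟨ ∑-distrib-+ (λ v → 2 * 𝟙 (deg v ≟ 0)) (λ v → 𝟙 (deg v ≟ 1) + deg v) ⟩
    ∑[ v < n ] (2 * 𝟙 (deg v ≟ 0)) + ∑[ v < n ] (𝟙 (deg v ≟ 1) + deg v)
      ≡⟨ cong₂ _+_ (sym (*-distribˡ-sum 2 (λ v → 𝟙 (deg v ≟ 0))))
                   (∑-distrib-+ (λ v → 𝟙 (deg v ≟ 1)) deg) ⟩
    2 * ∑[ v < n ] 𝟙 (deg v ≟ 0) + (∑[ v < n ] 𝟙 (deg v ≟ 1) + ∑[ v < n ] deg v)
      ≤⟨ +-mono-≤ (*-monoʳ-≤ 2 ∑-isolated≤1) (+-mono-≤ ∑-pendant≤ (∑-degreeIn≤ T≤r)) ⟩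
    2 + suc r * length T ∎
    where deg = degreeIn T

  testCover-size-bound : ∀ {r} → EdgesAtMost r T → n * 2 ≤ 2 + suc r * length T
  testCover-size-bound {r} T≤r = begin
    n * 2                                ≡⟨ ∑-const n 2 ⟨
    ∑[ v < n ] 2                         ≤⟨ ∑-mono-≤ (λ v → 2≤potential (degreeIn T v)) ⟩
    ∑[ v < n ] potential (degreeIn T v)  ≤⟨ ∑-potential≤ T≤r ⟩
    2 + suc r * length T                 ∎

  testCover-size-bound-strict : ∀ {r} → EdgesAtMost r T → ∀ v → 3 ≤ degreeIn T v →
                                n * 2 < 2 + suc r * length T
  testCover-size-bound-strict {r} T≤r v 3≤deg = begin-strict
    n * 2                                ≡⟨ ∑-const n 2 ⟨
    ∑[ v < n ] 2                         <⟨ ∑-mono-< (λ u → 2≤potential (degreeIn T u)) v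
                                              (≤-trans 3≤deg (≤potential (degreeIn T v))) ⟩
    ∑[ v < n ] potential (degreeIn T v)  ≤⟨ ∑-potential≤ T≤r ⟩
    2 + suc r * length T                 ∎

ceilDiv-≤ : ∀ {a b t} → a ≤ suc b * t → ceilDiv a b ≤ t
ceilDiv-≤ {a} {b} {t} a≤ = s≤s⁻¹ (m<n*o⇒m/o<n (begin-strict
  a + b              <⟨ +-monoʳ-< a (n<1+n b) ⟩
  a + suc b          ≤⟨ +-monoˡ-≤ (suc b) a≤ ⟩
  suc b * t + suc b  ≡⟨ +-comm (suc b * t) (suc b) ⟩
  suc b + suc b * t  ≡⟨ cong (suc b +_) (*-comm (suc b) t) ⟩
  suc t * suc b      ∎))
  where open ≤-Reasoning

2[n∸1]≤ : ∀ n {k} → n * 2 ≤ 2 + k → 2 * (n ∸ 1) ≤ k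
2[n∸1]≤ zero        _  = z≤n
2[n∸1]≤ (suc m) {k} le = subst (_≤ k) (*-comm m 2) (+-cancelˡ-≤ 2 (m * 2) k le)

testCover-ceilDiv≤ : ∀ {n r} {T : List (Subset n)} → IsTestCover T → EdgesAtMost r T →
                     ceilDiv (2 * (n ∸ 1)) r ≤ length T
testCover-ceilDiv≤ {n} cover T≤r = ceilDiv-≤ (2[n∸1]≤ n (testCover-size-bound cover T≤r))

extremal⇒degreeIn≤2 : ∀ {n r} {T : List (Subset n)} → IsTestCover T → EdgesAtMost r T →
                       suc r * length T ≡ 2 * (n ∸ 1) → ∀ v → degreeIn T v ≤ 2
extremal⇒degreeIn≤2 {suc m} {r} {T} cover T≤r extremal v with degreeIn T v ≤? 2
... | yes deg≤2 = deg≤2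
... | no  deg≰2 = contradiction (sym extremal)
                    (<⇒≢ (2m<k (testCover-size-bound-strict cover T≤r v (≰⇒> deg≰2))))
  where
  2m<k : ∀ {k} → suc m * 2 < 2 + k → 2 * m < k
  2m<k {k} lt = subst (_< k) (*-comm m 2) (+-cancelˡ-< 2 (m * 2) k lt)

data SplitView {m k : ℕ} : Fin (m + k) → Set where
  left  : (i : Fin m) → SplitView (i ↑ˡ k)
  right : (j : Fin k) → SplitView (m ↑ʳ j)

splitView : ∀ m {k} (x : Fin (m + k)) → SplitView {m} {k} x
splitView zero    x       = right x
splitView (suc m) zero    = left zero
splitView (suc m) (suc x) with splitView m x
... | left i  = left (suc i)
... | right j = right j

∈-++⁺ˡ : ∀ {m k} {i : Fin m} {p : Subset m} {q : Subset k} → i ∈ p → i ↑ˡ k ∈ p ++ q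
∈-++⁺ˡ here        = here
∈-++⁺ˡ (there i∈p) = there (∈-++⁺ˡ i∈p)

∈-++⁻ˡ : ∀ {m k} {i : Fin m} (p : Subset m) {q : Subset k} → i ↑ˡ k ∈ p ++ q → i ∈ p
∈-++⁻ˡ {i = zero}  (_ ∷ p) here      = here
∈-++⁻ˡ {i = suc i} (_ ∷ p) (there h) = there (∈-++⁻ˡ p h)

∈-++⁺ʳ : ∀ {m k} {j : Fin k} (p : Subset m) {q : Subset k} → j ∈ q → m ↑ʳ j ∈ p ++ q
∈-++⁺ʳ []      j∈q = j∈q
∈-++⁺ʳ (_ ∷ p) j∈q = there (∈-++⁺ʳ p j∈q)

∈-++⁻ʳ : ∀ {m k} {j : Fin k} (p : Subset m) {q : Subset k} → m ↑ʳ j ∈ p ++ q → j ∈ q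
∈-++⁻ʳ []      h         = h
∈-++⁻ʳ (_ ∷ p) (there h) = ∈-++⁻ʳ p h

∣p++q∣≡∣p∣+∣q∣ : ∀ {m k} (p : Subset m) (q : Subset k) → ∣ p ++ q ∣ ≡ ∣ p ∣ + ∣ q ∣
∣p++q∣≡∣p∣+∣q∣ []            q = refl
∣p++q∣≡∣p∣+∣q∣ (inside ∷ p)  q = cong suc (∣p++q∣≡∣p∣+∣q∣ p q)
∣p++q∣≡∣p∣+∣q∣ (outside ∷ p) q = ∣p++q∣≡∣p∣+∣q∣ p q

Separates-++ˡ : ∀ {m k} {x y : Fin m} {p : Subset m} (q : Subset k) →
                Separates p x y → Separates (p ++ q) (x ↑ˡ k) (y ↑ˡ k)
Separates-++ˡ {p = p} q = Sum.map (Product.map ∈-++⁺ˡ (_∘ ∈-++⁻ˡ p)) (Product.map ∈-++⁺ˡ (_∘ ∈-++⁻ˡ p))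

Separates-++ʳ : ∀ {m k} {x y : Fin k} (p : Subset m) {q : Subset k} →
                Separates q x y → Separates (p ++ q) (m ↑ʳ x) (m ↑ʳ y)
Separates-++ʳ p = Sum.map (Product.map (∈-++⁺ʳ p) (_∘ ∈-++⁻ʳ p)) (Product.map (∈-++⁺ʳ p) (_∘ ∈-++⁻ʳ p))

Covers : ∀ {n} → List (Subset n) → Set
Covers {n} T = (v : Fin n) → Any (v ∈_) T

disjointUnion : ∀ {m k} → List (Subset m) → List (Subset k) → List (Subset (m + k))
disjointUnion {m} {k} T₁ T₂ = map (_++ ⊥) T₁ ++ₗ map (⊥ ++_) T₂

module _ {m k : ℕ} (T₁ : List (Subset m)) (T₂ : List (Subset k)) where

  length-disjointUnion : length (disjointUnion T₁ T₂) ≡ length T₁ + length T₂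
  length-disjointUnion =
    trans (length-++ (map (_++ ⊥) T₁)) (cong₂ _+_ (length-map _ T₁) (length-map _ T₂))

  disjointUnion-edgesAtMost : ∀ {r} → EdgesAtMost r T₁ → EdgesAtMost r T₂ →
                              EdgesAtMost r (disjointUnion T₁ T₂)
  disjointUnion-edgesAtMost {r} T₁≤r T₂≤r =
    All.++⁺ (All.map⁺ (All.map (λ {e} → subst (_≤ r) (sym (∣e++⊥∣ e))) T₁≤r))
            (All.map⁺ (All.map (λ {e} → subst (_≤ r) (sym (∣⊥++e∣ e))) T₂≤r))
    where
    ∣e++⊥∣ : ∀ e → ∣ e ++ ⊥ {k} ∣ ≡ ∣ e ∣
    ∣e++⊥∣ e = trans (∣p++q∣≡∣p∣+∣q∣ e (⊥ {k})) (trans (cong (∣ e ∣ +_) (∣⊥∣≡0 k)) (+-identityʳ ∣ e ∣))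
    ∣⊥++e∣ : ∀ e → ∣ ⊥ {m} ++ e ∣ ≡ ∣ e ∣
    ∣⊥++e∣ e = trans (∣p++q∣≡∣p∣+∣q∣ (⊥ {m}) e) (cong (_+ ∣ e ∣) (∣⊥∣≡0 m))

  separates-across : Covers T₂ → ∀ i j →
                     Any (λ e → Separates e (i ↑ˡ k) (m ↑ʳ j)) (disjointUnion T₁ T₂)
  separates-across covers₂ i j =
    Any.++⁺ʳ _ (Any.map⁺ (Any.map (λ j∈e → inj₂ (∈-++⁺ʳ ⊥ j∈e , ∉⊥ ∘ ∈-++⁻ˡ ⊥)) (covers₂ j)))

  disjointUnion-testCover : IsTestCover T₁ → IsTestCover T₂ → Covers T₂ →
                            IsTestCover (disjointUnion T₁ T₂)
  disjointUnion-testCover cover₁ cover₂ covers₂ x y x≢y with splitView m x | splitView m y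
  ... | left i  | left i′  =
    Any.++⁺ˡ (Any.map⁺ (Any.map (Separates-++ˡ ⊥) (cover₁ i i′ (x≢y ∘ cong (_↑ˡ k)))))
  ... | right j | right j′ =
    Any.++⁺ʳ _ (Any.map⁺ (Any.map (Separates-++ʳ ⊥) (cover₂ j j′ (x≢y ∘ cong (m ↑ʳ_)))))
  ... | left i  | right j  = separates-across covers₂ i j
  ... | right j | left i   = Any.map swap (separates-across covers₂ i j)

triangle : ℕ → ℕ
triangle zero    = zero
triangle (suc k) = triangle k + suc k

2*triangle : ∀ k → 2 * triangle k ≡ k * suc k
2*triangle zero    = refl
2*triangle (suc k) = begin
  2 * (triangle k + suc k)    ≡⟨ *-distribˡ-+ 2 (triangle k) (suc k) ⟩
  2 * triangle k + 2 * suc k  ≡⟨ cong (_+ 2 * suc k) (2*triangle k) ⟩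
  k * suc k + 2 * suc k       ≡⟨ *-distribʳ-+ (suc k) k 2 ⟨
  (k + 2) * suc k             ≡⟨ cong (_* suc k) (+-comm k 2) ⟩
  suc (suc k) * suc k         ≡⟨ *-comm (suc (suc k)) (suc k) ⟩
  suc k * suc (suc k)         ∎
  where open ≡-Reasoning

0<triangle : ∀ {k} → 0 < k → 0 < triangle k
0<triangle {suc k} _ = ≤-trans (s≤s z≤n) (m≤n+m (suc k) (triangle k))

-- The vertices of block k are the edges of the complete graph on k + 1 nodes, and blockEdge k i
-- is the star of node i; the star of one node is left out. Going to k + 1 adds a node 0: new
-- vertex suc i is its edge to node suc i, new vertex 0 its edge to the node left out.
blockEdge : ∀ k → Fin k → Subset (triangle k)
blockEdge (suc k) zero    = ⊥ {triangle k} ++ ⊤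
blockEdge (suc k) (suc i) = blockEdge k i ++ (outside ∷ ⁅ i ⁆)

∣blockEdge∣ : ∀ k i → ∣ blockEdge k i ∣ ≡ k
∣blockEdge∣ (suc k) zero    = begin
  ∣ ⊥ {triangle k} ++ ⊤ ∣              ≡⟨ ∣p++q∣≡∣p∣+∣q∣ (⊥ {triangle k}) ⊤ ⟩
  ∣ ⊥ {triangle k} ∣ + ∣ ⊤ {suc k} ∣   ≡⟨ cong₂ _+_ (∣⊥∣≡0 (triangle k)) (∣⊤∣≡n (suc k)) ⟩
  suc k                                ∎
  where open ≡-Reasoning
∣blockEdge∣ (suc k) (suc i) = begin
  ∣ blockEdge k i ++ (outside ∷ ⁅ i ⁆) ∣  ≡⟨ ∣p++q∣≡∣p∣+∣q∣ (blockEdge k i) (outside ∷ ⁅ i ⁆) ⟩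
  ∣ blockEdge k i ∣ + ∣ ⁅ i ⁆ ∣           ≡⟨ cong₂ _+_ (∣blockEdge∣ k i) (∣⁅x⁆∣≡1 i) ⟩
  k + 1                                  ≡⟨ +-comm k 1 ⟩
  suc k                                  ∎
  where open ≡-Reasoning

blockEdge-covers : ∀ k (v : Fin (triangle k)) → ∃ λ i → v ∈ blockEdge k i
blockEdge-covers (suc k) v with splitView (triangle k) v
... | left u  = let i , u∈e = blockEdge-covers k u in suc i , ∈-++⁺ˡ u∈e
... | right j = zero , ∈-++⁺ʳ (⊥ {triangle k}) ∈⊤

∈-outside∷⁅⁆ : ∀ {k} {i : Fin k} {j} → j ∈ outside ∷ ⁅ i ⁆ → j ≡ suc i
∈-outside∷⁅⁆ {i = i} (there j∈⁅i⁆) = cong suc (x∈⁅y⁆⇒x≡y i j∈⁅i⁆)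

new-separated : ∀ k (i : Fin k) j → j ≢ suc i →
                Separates (blockEdge (suc k) (suc i)) (triangle k ↑ʳ suc i) (triangle k ↑ʳ j)
new-separated k i j j≢ =
  inj₁ (∈-++⁺ʳ (blockEdge k i) (there (x∈⁅x⁆ i)) , j≢ ∘ ∈-outside∷⁅⁆ ∘ ∈-++⁻ʳ (blockEdge k i))

blockEdge-separates : ∀ k (x y : Fin (triangle k)) → x ≢ y → ∃ λ i → Separates (blockEdge k i) x y
blockEdge-separates (suc k) x y x≢y with splitView (triangle k) x | splitView (triangle k) y
... | left u  | left u′ =
  let i , sep = blockEdge-separates k u u′ (x≢y ∘ cong (_↑ˡ suc k)) in suc i , Separates-++ˡ _ sep
... | left u  | right j = zero , inj₂ (∈-++⁺ʳ (⊥ {triangle k}) ∈⊤ , ∉⊥ ∘ ∈-++⁻ˡ (⊥ {triangle k}))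
... | right j | left u  = zero , inj₁ (∈-++⁺ʳ (⊥ {triangle k}) ∈⊤ , ∉⊥ ∘ ∈-++⁻ˡ (⊥ {triangle k}))
... | right zero    | right zero     = contradiction refl x≢y
... | right (suc i) | right j′       =
  suc i , new-separated k i j′ (≢-sym (x≢y ∘ cong (triangle k ↑ʳ_)))
... | right zero    | right (suc i′) = suc i′ , swap (new-separated k i′ zero λ ())

block : ∀ k → List (Subset (triangle k))
block k = tabulate (blockEdge k)

block-length : ∀ k → length (block k) ≡ k
block-length k = length-tabulate (blockEdge k)

block-edgesAtMost : ∀ k → EdgesAtMost k (block k)
block-edgesAtMost k = All.tabulate⁺ (λ i → ≤-reflexive (∣blockEdge∣ k i))

block-covers : ∀ k → Covers (block k)
block-covers k v = let i , v∈e = blockEdge-covers k v in Any.tabulate⁺ i v∈e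

block-testCover : ∀ k → IsTestCover (block k)
block-testCover k x y x≢y = let i , sep = blockEdge-separates k x y x≢y in Any.tabulate⁺ i sep

tightOrder : ℕ → ℕ → ℕ
tightOrder r zero    = 1
tightOrder r (suc j) = tightOrder r j + triangle r

tight : ∀ r j → List (Subset (tightOrder r j))
tight r zero    = []
tight r (suc j) = disjointUnion (tight r j) (block r)

tightOrder≡1+j*triangle : ∀ r j → tightOrder r j ≡ suc (j * triangle r)
tightOrder≡1+j*triangle r zero    = refl
tightOrder≡1+j*triangle r (suc j) =
  trans (cong (_+ triangle r) (tightOrder≡1+j*triangle r j))
        (cong suc (+-comm (j * triangle r) (triangle r)))

tight-length : ∀ r j → length (tight r j) ≡ j * r
tight-length r zero    = refl
tight-length r (suc j) = begin
  length (disjointUnion (tight r j) (block r))  ≡⟨ length-disjointUnion (tight r j) (block r) ⟩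
  length (tight r j) + length (block r)         ≡⟨ cong₂ _+_ (tight-length r j) (block-length r) ⟩
  j * r + r                                     ≡⟨ +-comm (j * r) r ⟩
  suc j * r                                     ∎
  where open ≡-Reasoning

tight-edgesAtMost : ∀ r j → EdgesAtMost r (tight r j)
tight-edgesAtMost r zero    = []
tight-edgesAtMost r (suc j) =
  disjointUnion-edgesAtMost (tight r j) (block r) (tight-edgesAtMost r j) (block-edgesAtMost r)

tight-testCover : ∀ r j → IsTestCover (tight r j)
tight-testCover r zero    zero zero 0≢0 = contradiction refl 0≢0
tight-testCover r (suc j) =
  disjointUnion-testCover (tight r j) (block r) (tight-testCover r j) (block-testCover r) (block-covers r)

tight-extremal : ∀ r j → suc r * length (tight r j) ≡ 2 * (tightOrder r j ∸ 1)
tight-extremal r j = begin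
  suc r * length (tight r j)  ≡⟨ cong (suc r *_) (tight-length r j) ⟩
  suc r * (j * r)             ≡⟨ solve 2 (λ r j → (con 1 :+ r) :* (j :* r) := j :* (r :* (con 1 :+ r))) refl r j ⟩
  j * (r * suc r)             ≡⟨ cong (j *_) (2*triangle r) ⟨
  j * (2 * triangle r)        ≡⟨ solve 2 (λ j t → j :* (con 2 :* t) := con 2 :* (j :* t)) refl j (triangle r) ⟩
  2 * (j * triangle r)        ≡⟨ cong (λ n → 2 * (n ∸ 1)) (tightOrder≡1+j*triangle r j) ⟨
  2 * (tightOrder r j ∸ 1)    ∎
  where open ≡-Reasoning
        open +-*-Solver

j≤tightOrder : ∀ r j → 0 < r → j ≤ tightOrder r j
j≤tightOrder r j 0<r = begin
  j                     ≤⟨ m≤m*n j (triangle r) {{>-nonZero (0<triangle 0<r)}} ⟩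
  j * triangle r        ≤⟨ n≤1+n _ ⟩
  suc (j * triangle r)  ≡⟨ tightOrder≡1+j*triangle r j ⟨
  tightOrder r j        ∎
  where open ≤-Reasoning

proposition4 : (r : ℕ) → r ≥ 2 →
    ((n : ℕ) (E : Hypergraph n) → EdgesAtMost r E →
      (T : List (Subset n)) → T ⊆ E → IsTestCover T →
        ceilDiv (2 * (n ∸ 1)) r ≤ length T)
    × ((m : ℕ) → Σ ℕ λ n → m ≤ n × Σ (Hypergraph n) λ E → EdgesAtMost r E ×
        Σ (List (Subset n)) λ T → T ⊆ E × IsTestCover T ×
          (suc r) * length T ≡ 2 * (n ∸ 1))
    × ((n : ℕ) (E : Hypergraph n) → EdgesAtMost r E →
      (T : List (Subset n)) → T ⊆ E → IsTestCover T →
        (suc r) * length T ≡ 2 * (n ∸ 1) →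
        (v : Fin n) → degreeIn T v ≤ 2)
proposition4 r r≥2 =
    (λ n E E≤r T T⊆E cover → testCover-ceilDiv≤ cover (All-resp-⊆ T⊆E E≤r))
  , (λ m → tightOrder r m , j≤tightOrder r m (≤-trans (s≤s z≤n) r≥2) , tight r m , tight-edgesAtMost r m ,
           tight r m , ⊆-refl , tight-testCover r m , tight-extremal r m)
  , (λ n E E≤r T T⊆E cover → extremal⇒degreeIn≤2 cover (All-resp-⊆ T⊆E E≤r))
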